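{- For $n\ge 8$, $c_1(n,P_2)=3$, where $P_2$ is the $3$-graph with vertex set $\{v_1,\dots,v_5\}$ and edges $\{v_1,v_2,v_3\},\{v_3,v_4,v_5\}$.
   Context: For a $3$-graph $G$, $\delta_1(G)$ is the minimum vertex degree (number of edges containing a vertex). $G$ has an $F$-covering if every vertex lies in a copy of $F$; $c_1(n,F)$ is the maximum of $\delta_1(G)$ over $n$-vertex $3$-graphs $G$ with no $F$-covering. -}

module Defs where

open import Data.Nat using (ℕ; zero; suc; _⊓_; _<ᵇ_)
open import Data.Bool using (Bool; true; false; _∧_)
open import Data.Fin using (Fin; toℕ)
open import Data.Product using (_×_; _,_; Σ; ∃)
open import Data.List using (List; length; filterᵇ; cartesianProduct; allFin)
import Data.Vec as Vec
open import Function.Definitions using (Injective)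
open import Relation.Binary.PropositionalEquality using (_≡_; _≢_)

-- The indicator is symmetric
-- under all permutations (generated by the two swaps below), and edges
-- consist of three distinct vertices.
record ThreeGraph (n : ℕ) : Set where
  field
    edge      : Fin n → Fin n → Fin n → Bool
    sym₁₂     : ∀ a b c → edge a b c ≡ edge b a c
    sym₂₃     : ∀ a b c → edge a b c ≡ edge a c b
    distinct₁₂ : ∀ a b c → edge a b c ≡ true → a ≢ b
    distinct₁₃ : ∀ a b c → edge a b c ≡ true → a ≢ c
    distinct₂₃ : ∀ a b c → edge a b c ≡ true → b ≢ c

open ThreeGraph public

-- degree of v: number of edges containing v, i.e. number of unordered
-- pairs {a,b} (counted once via toℕ a < toℕ b) with {v,a,b} an edge.
degree : ∀ {n} → ThreeGraph n → Fin n → ℕ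
degree {n} G v =
  length (filterᵇ (λ p → (toℕ (Data.Product.proj₁ p) <ᵇ toℕ (Data.Product.proj₂ p))
                          ∧ edge G v (Data.Product.proj₁ p) (Data.Product.proj₂ p))
                  (cartesianProduct (allFin n) (allFin n)))

-- minimum vertex degree δ₁(G) (convention: 0 for the empty vertex set)
δ₁ : ∀ {n} → ThreeGraph n → ℕ
δ₁ {zero}  G = 0
δ₁ {suc m} G = Vec.foldr₁ _⊓_ (Vec.tabulate (degree G))

-- The 3-graph P₂: vertices v₁..v₅ (Fin 5 = 0..4), edges {v₁,v₂,v₃}, {v₃,v₄,v₅}.
-- A copy of P₂ in G: an injective map f : Fin 5 → Fin n sending both edges
-- of P₂ to edges of G (not necessarily induced).
CopyOfP₂ : ∀ {n} → ThreeGraph n → (Fin 5 → Fin n) → Set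
CopyOfP₂ G f =
  Injective _≡_ _≡_ f ×
  (edge G (f Fin.zero) (f (Fin.suc Fin.zero)) (f (Fin.suc (Fin.suc Fin.zero))) ≡ true) ×
  (edge G (f (Fin.suc (Fin.suc Fin.zero))) (f (Fin.suc (Fin.suc (Fin.suc Fin.zero))))
          (f (Fin.suc (Fin.suc (Fin.suc (Fin.suc Fin.zero))))) ≡ true)
  where import Data.Fin as Fin

HasP₂Covering : ∀ {n} → ThreeGraph n → Set
HasP₂Covering {n} G =
  (v : Fin n) → Σ (Fin 5 → Fin n) λ f → CopyOfP₂ G f × ∃ λ (i : Fin 5) → f i ≡ v

{-# OPTIONS --safe #-}
-- If every vertex has degree at least 4, every vertex v is covered: two edges at v meeting
-- only in v form a P₂ centred at v; otherwise they are {v,s,t} and {v,s,u}, and t lies in a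
-- further edge {t,p,q} with {p,q} ∉ {{v,s},{s,u},{v,u}}, which together with one of them is a
-- P₂ centred at v, s or t.  Conversely, in the disjoint union of complete 3-graphs on 4 and on
-- n − 4 ≥ 4 vertices every degree is at least 3, with equality on the K₄; both edges of a P₂
-- contain its middle vertex, so a copy lies inside one clique and none meets the K₄.
module Submission where

open import Defs
open import Data.Nat using (ℕ; zero; suc; _+_; _≤_; _<_; _<ᵇ_; _⊓_; _≤?_; s≤s; z≤n)
open import Data.Nat.Properties
  using (≤-refl; ≤-trans; ≤-antisym; <-irrefl; <-asym; <-trans; ≤⇒≯; ≰⇒>; m⊓n≤m; m⊓n≤n; ⊓-glb; <ᵇ⇒<; <⇒<ᵇ)
open import Data.Bool using (Bool; true; false; T; _∧_; if_then_else_)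
open import Data.Bool.Properties using (T-∧; T-≡)
import Data.Bool.Properties as Bool
open import Data.Fin using (Fin; toℕ; fromℕ<)
open import Data.Fin.Properties using (_≟_; pigeonhole; fromℕ<-injective; toℕ-injective)
import Data.Fin.Properties as Fin
open import Data.Product using (_×_; _,_; proj₁; proj₂; Σ; ∃; ∃₂)
open import Data.Product.Properties using (≡-dec)
open import Data.Sum using (_⊎_; inj₁; inj₂)
open import Data.Empty using (⊥-elim)
open import Data.List using (List; []; _∷_; length; map; filterᵇ; cartesianProduct; allFin)
open import Data.List.Properties using (length-map)
open import Data.List.Relation.Unary.Any using (here; there)
import Data.List.Relation.Unary.Any as Any
open import Data.List.Relation.Unary.All using (All; []; _∷_)
import Data.List.Relation.Unary.All as All
open import Data.List.Relation.Unary.AllPairs using ([]; _∷_)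
open import Data.List.Relation.Unary.Unique.Propositional using (Unique)
import Data.List.Relation.Unary.Unique.Propositional.Properties as Unique
open import Data.List.Membership.Propositional using (_∈_; _∉_; find)
open import Data.List.Membership.Propositional.Properties
  using (∈-map⁺; ∈-filter⁺; ∈-filter⁻; ∈-cartesianProduct⁺; ∈-allFin)
import Data.List.Membership.DecPropositional as DecMembership
open import Data.Vec using (lookup; foldr₁; tabulate)
import Data.Vec as Vec
open import Data.Vec.Relation.Unary.All using ([]; _∷_)
open import Data.Vec.Relation.Unary.Unique.Propositional using ([]; _∷_)
open import Data.Vec.Relation.Unary.Unique.Propositional.Properties using (lookup-injective)
open import Function using (_∘_; mk⇔; Equivalence)
open import Function.Definitions using (Injective)
open import Relation.Nullary using (¬_; Dec; yes; no; does; ¬?)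
open import Relation.Nullary.Decidable using (T?; does-⇔; _×-dec_)
open import Relation.Binary.Definitions using (DecidableEquality)
open import Relation.Binary.PropositionalEquality

module _ {A : Set} where

  remove : ∀ {x : A} xs → x ∈ xs → List A
  remove (_ ∷ xs) (here _)  = xs
  remove (y ∷ xs) (there p) = y ∷ remove xs p

  length-remove : ∀ {x : A} xs (p : x ∈ xs) → suc (length (remove xs p)) ≡ length xs
  length-remove (_ ∷ xs) (here _)  = refl
  length-remove (_ ∷ xs) (there p) = cong suc (length-remove xs p)

  ∈-remove : ∀ {x y : A} xs (p : x ∈ xs) → y ∈ xs → y ≢ x → y ∈ remove xs p
  ∈-remove (_ ∷ _)  (here refl) (here refl) y≢x = ⊥-elim (y≢x refl)
  ∈-remove (_ ∷ _)  (here refl) (there q)   _   = q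
  ∈-remove (_ ∷ _)  (there p)   (here e)    _   = here e
  ∈-remove (_ ∷ xs) (there p)   (there q)   y≢x = there (∈-remove xs p q y≢x)

  unique-⊆⇒length≤ : ∀ {xs ys : List A} → Unique xs → (∀ {z} → z ∈ xs → z ∈ ys) →
                     length xs ≤ length ys
  unique-⊆⇒length≤ {[]}     _          _     = z≤n
  unique-⊆⇒length≤ {x ∷ xs} {ys} (x∉xs ∷ u) xs⊆ys =
    subst (suc (length xs) ≤_) (length-remove ys x∈ys)
      (s≤s (unique-⊆⇒length≤ u λ z∈xs →
        ∈-remove ys x∈ys (xs⊆ys (there z∈xs)) λ { refl → All.lookup x∉xs z∈xs refl }))
    where x∈ys = xs⊆ys (here refl)

  module _ (_≟ₐ_ : DecidableEquality A) where
    open DecMembership _≟ₐ_ using (_∈?_)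

    unique-longer⇒∃∉ : ∀ {xs ys : List A} → Unique xs → length ys < length xs →
                       ∃ λ x → x ∈ xs × x ∉ ys
    unique-longer⇒∃∉ {xs} {ys} u ys<xs with Any.any? (λ x → ¬? (x ∈? ys)) xs
    ... | yes some∉ = find some∉
    ... | no  none∉ = ⊥-elim (≤⇒≯ (unique-⊆⇒length≤ u xs⊆ys) ys<xs)
      where
      xs⊆ys : ∀ {z} → z ∈ xs → z ∈ ys
      xs⊆ys {z} z∈xs with z ∈? ys
      ... | yes z∈ys = z∈ys
      ... | no  z∉ys = ⊥-elim (none∉ (Any.map (λ { refl → z∉ys }) z∈xs))

from-does : ∀ {P : Set} (p? : Dec P) → does p? ≡ true → P
from-does (yes p) _ = p

injective⇒≤ : ∀ {m n k} (f : Fin m → Fin n) → Injective _≡_ _≡_ f → (∀ i → toℕ (f i) < k) → m ≤ k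
injective⇒≤ {m} {k = k} f f-inj f<k with m ≤? k
... | yes m≤k = m≤k
... | no  m≰k with pigeonhole (≰⇒> m≰k) (λ i → fromℕ< (f<k i))
...   | i , j , i<j , same =
  ⊥-elim (Fin.<-irrefl (f-inj (toℕ-injective (fromℕ<-injective _ _ (f<k i) (f<k j) same))) i<j)

min-tabulate≤ : ∀ {m} (f : Fin (suc m) → ℕ) i → foldr₁ _⊓_ (tabulate f) ≤ f i
min-tabulate≤ {zero}  f Fin.zero    = ≤-refl
min-tabulate≤ {suc m} f Fin.zero    = m⊓n≤m _ _
min-tabulate≤ {suc m} f (Fin.suc i) = ≤-trans (m⊓n≤n _ _) (min-tabulate≤ (f ∘ Fin.suc) i)

≤-min-tabulate : ∀ {m k} (f : Fin (suc m) → ℕ) → (∀ i → k ≤ f i) → k ≤ foldr₁ _⊓_ (tabulate f)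
≤-min-tabulate {zero}  f k≤f = k≤f Fin.zero
≤-min-tabulate {suc m} f k≤f = ⊓-glb (k≤f Fin.zero) (≤-min-tabulate (f ∘ Fin.suc) (k≤f ∘ Fin.suc))

δ₁≤degree : ∀ {n} (G : ThreeGraph n) v → δ₁ G ≤ degree G v
δ₁≤degree {suc _} G = min-tabulate≤ (degree G)

≤δ₁ : ∀ {m k} (G : ThreeGraph (suc m)) → (∀ v → k ≤ degree G v) → k ≤ δ₁ G
≤δ₁ G = ≤-min-tabulate (degree G)

Pair : ℕ → Set
Pair n = Fin n × Fin n

inLink : ∀ {n} → ThreeGraph n → Fin n → Pair n → Bool
inLink G v p = (toℕ (proj₁ p) <ᵇ toℕ (proj₂ p)) ∧ edge G v (proj₁ p) (proj₂ p)

_≋_ : ∀ {n} → Pair n → Pair n → Set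
(a , b) ≋ (x , y) = (a ≡ x × b ≡ y) ⊎ (a ≡ y × b ≡ x)

Avoids : ∀ {n} → Pair n → List (Pair n) → Set
Avoids p = All (λ xy → ¬ p ≋ xy)

sort : ∀ {n} → Pair n → Pair n
sort (x , y) = if toℕ x <ᵇ toℕ y then (x , y) else (y , x)

sort-≋ : ∀ {n} {a b : Fin n} {xy} → toℕ a < toℕ b → (a , b) ≋ xy → (a , b) ≡ sort xy
sort-≋ {a = a} {b} a<b (inj₁ (refl , refl)) with toℕ a <ᵇ toℕ b in a<ᵇb
... | true  = refl
... | false = ⊥-elim (subst T a<ᵇb (<⇒<ᵇ a<b))
sort-≋ {a = a} {b} a<b (inj₂ (refl , refl)) with toℕ b <ᵇ toℕ a in b<ᵇa
... | true  = ⊥-elim (<-asym a<b (<ᵇ⇒< _ _ (subst T (sym b<ᵇa) _)))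
... | false = refl

Covered : ∀ {n} → ThreeGraph n → Fin n → Set
Covered {n} G v = Σ (Fin 5 → Fin n) λ f → CopyOfP₂ G f × ∃ λ i → f i ≡ v

pattern 0F = Fin.zero
pattern 1F = Fin.suc 0F
pattern 2F = Fin.suc 1F
pattern 3F = Fin.suc 2F
pattern 4F = Fin.suc 3F
pattern 5F = Fin.suc 4F
pattern 6F = Fin.suc 5F
pattern 7F = Fin.suc 6F
pattern suc⁴ i = Fin.suc (Fin.suc (Fin.suc (Fin.suc i)))

fan : ∀ {n} → Fin n → Fin n → Fin n → Fin n → Fin n → Fin 5 → Fin n
fan x p q r s = lookup (p Vec.∷ q Vec.∷ x Vec.∷ r Vec.∷ s Vec.∷ Vec.[])

module _ {n} (G : ThreeGraph n) where

  link : Fin n → List (Pair n)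
  link v = filterᵇ (inLink G v) (cartesianProduct (allFin n) (allFin n))

  unique-link : ∀ v → Unique (link v)
  unique-link v = Unique.filter⁺ (T? ∘ inLink G v)
    (Unique.cartesianProduct⁺ (Unique.allFin⁺ n) (Unique.allFin⁺ n))

  length≤degree : ∀ {v xs} → Unique xs → All (T ∘ inLink G v) xs → length xs ≤ degree G v
  length≤degree {v} u xs-in-link = unique-⊆⇒length≤ u λ {(a , b)} p∈xs →
    ∈-filter⁺ (T? ∘ inLink G v) (∈-cartesianProduct⁺ (∈-allFin a) (∈-allFin b)) (All.lookup xs-in-link p∈xs)

  ∈-link⁻ : ∀ {v p} → p ∈ link v → T (inLink G v p)
  ∈-link⁻ {v} = proj₂ ∘ ∈-filter⁻ (T? ∘ inLink G v) {xs = cartesianProduct (allFin n) (allFin n)}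

  degree≤length : ∀ v {ys} → (∀ {p} → T (inLink G v p) → p ∈ ys) → degree G v ≤ length ys
  degree≤length v ⊇link = unique-⊆⇒length≤ (unique-link v) (⊇link ∘ ∈-link⁻)

  -- Link pairs are sorted, so comparing with the sorted ys turns "no unordered repetition"
  -- into plain non-membership, to which counting applies.
  another-edge : ∀ v (ys : List (Pair n)) → length ys < degree G v →
                 ∃₂ λ a b → edge G v a b ≡ true × Avoids (a , b) ys
  another-edge v ys ys<deg
    with unique-longer⇒∃∉ (≡-dec _≟_ _≟_) (unique-link v)
           (subst (_< degree G v) (sym (length-map sort ys)) ys<deg)
  ... | (a , b) , ab∈link , ab∉sorted with Equivalence.to T-∧ (∈-link⁻ ab∈link)
  ...   | a<ᵇb , vab = a , b , Equivalence.to T-≡ vab , All.tabulate λ xy∈ys ab≋xy →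
    ab∉sorted (subst (_∈ map sort ys) (sym (sort-≋ (<ᵇ⇒< _ _ a<ᵇb) ab≋xy)) (∈-map⁺ sort xy∈ys))

  link-triangle⇒3≤degree : ∀ v a b c → toℕ a < toℕ b → toℕ b < toℕ c →
    edge G v a b ≡ true → edge G v a c ≡ true → edge G v b c ≡ true → 3 ≤ degree G v
  link-triangle⇒3≤degree _ _ _ _ a<b b<c vab vac vbc =
    length≤degree ((b≢c ∘ cong proj₂ ∷ a≢b ∘ cong proj₁ ∷ []) ∷ (a≢b ∘ cong proj₁ ∷ []) ∷ [] ∷ [])
      (inLink-intro a<b vab ∷ inLink-intro (<-trans a<b b<c) vac ∷ inLink-intro b<c vbc ∷ [])
    where
    inLink-intro : ∀ {v x y} → toℕ x < toℕ y → edge G v x y ≡ true → T (inLink G v (x , y))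
    inLink-intro x<y vxy = Equivalence.from T-∧ (<⇒<ᵇ x<y , Equivalence.from T-≡ vxy)
    a≢b = λ a≡b → <-irrefl (cong toℕ a≡b) a<b
    b≢c = λ b≡c → <-irrefl (cong toℕ b≡c) b<c

  edge-swap₁₂ : ∀ {a b c} → edge G a b c ≡ true → edge G b a c ≡ true
  edge-swap₁₂ {a} {b} {c} = trans (sym (sym₁₂ G a b c))

  edge-swap₂₃ : ∀ {a b c} → edge G a b c ≡ true → edge G a c b ≡ true
  edge-swap₂₃ {a} {b} {c} = trans (sym (sym₂₃ G a b c))

  edge-rotˡ : ∀ {a b c} → edge G a b c ≡ true → edge G b c a ≡ true
  edge-rotˡ = edge-swap₂₃ ∘ edge-swap₁₂

  edge-rotʳ : ∀ {a b c} → edge G a b c ≡ true → edge G c a b ≡ true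
  edge-rotʳ = edge-swap₁₂ ∘ edge-swap₂₃

  fan-copy : ∀ {x p q r s} → edge G x p q ≡ true → edge G x r s ≡ true →
             p ≢ r → p ≢ s → q ≢ r → q ≢ s → CopyOfP₂ G (fan x p q r s)
  fan-copy {x} {p} {q} {r} {s} xpq xrs p≢r p≢s q≢r q≢s =
    (λ {i} {j} → lookup-injective distinct i j) , edge-rotˡ xpq , xrs
    where
    x≢p = distinct₁₂ G _ _ _ xpq
    x≢q = distinct₁₃ G _ _ _ xpq
    p≢q = distinct₂₃ G _ _ _ xpq
    x≢r = distinct₁₂ G _ _ _ xrs
    x≢s = distinct₁₃ G _ _ _ xrs
    r≢s = distinct₂₃ G _ _ _ xrs
    distinct = (p≢q ∷ x≢p ∘ sym ∷ p≢r ∷ p≢s ∷ []) ∷ (x≢q ∘ sym ∷ q≢r ∷ q≢s ∷ []) ∷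
               (x≢r ∷ x≢s ∷ []) ∷ (r≢s ∷ []) ∷ [] ∷ []

  covered-by-copy : ∀ {f} → CopyOfP₂ G f → ∀ i → Covered G (f i)
  covered-by-copy copy i = _ , copy , i , refl

  module _ (4≤degree : ∀ v → 4 ≤ degree G v) where

    covered-by-shared-pair : ∀ {v s t u} → edge G v s t ≡ true → edge G v s u ≡ true → t ≢ u →
                             Covered G v
    covered-by-shared-pair {v} {s} {t} {u} vst vsu t≢u =
      via-third-edge (another-edge t ((v , s) ∷ (s , u) ∷ (v , u) ∷ []) (4≤degree t))
      where
      t≢v = distinct₁₃ G _ _ _ vst ∘ sym
      t≢s = distinct₂₃ G _ _ _ vst ∘ sym

      via-third-edge : (∃₂ λ p q → edge G t p q ≡ true ×
                                    Avoids (p , q) ((v , s) ∷ (s , u) ∷ (v , u) ∷ [])) →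
                       Covered G v
      via-third-edge (p , q , tpq , (pq≉vs ∷ pq≉su ∷ pq≉vu ∷ [])) with p ≟ v | q ≟ v | p ≟ s | q ≟ s
      ... | yes refl | _        | _        | _        = covered-by-copy
              (fan-copy (edge-swap₁₂ tpq) vsu t≢s t≢u (pq≉vs ∘ inj₁ ∘ (refl ,_)) (pq≉vu ∘ inj₁ ∘ (refl ,_))) 2F
      ... | no _     | yes refl | _        | _        = covered-by-copy
              (fan-copy (edge-rotʳ tpq) vsu t≢s t≢u (pq≉vs ∘ inj₂ ∘ (_, refl)) (pq≉vu ∘ inj₂ ∘ (_, refl))) 2F
      ... | no _     | no q≢v   | yes refl | _        = covered-by-copy
              (fan-copy (edge-swap₁₂ tpq) (edge-swap₁₂ vsu) t≢v t≢u q≢v (pq≉su ∘ inj₁ ∘ (refl ,_))) 3F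
      ... | no p≢v   | no _     | no _     | yes refl = covered-by-copy
              (fan-copy (edge-rotʳ tpq) (edge-swap₁₂ vsu) t≢v t≢u p≢v (pq≉su ∘ inj₂ ∘ (_, refl))) 3F
      ... | no p≢v   | no q≢v   | no p≢s   | no q≢s   = covered-by-copy
              (fan-copy (edge-rotʳ vst) tpq (p≢v ∘ sym) (q≢v ∘ sym) (p≢s ∘ sym) (q≢s ∘ sym)) 0F

    4≤degree⇒covering : HasP₂Covering G
    4≤degree⇒covering v with another-edge v [] (≤-trans (s≤s z≤n) (4≤degree v))
    ... | a , b , vab , [] with another-edge v ((a , b) ∷ []) (≤-trans (s≤s (s≤s z≤n)) (4≤degree v))
    ... | c , d , vcd , (cd≉ab ∷ []) with c ≟ a | c ≟ b | d ≟ a | d ≟ b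
    ... | yes refl | _        | _        | _        =
      covered-by-shared-pair vab vcd λ { refl → cd≉ab (inj₁ (refl , refl)) }
    ... | no _     | yes refl | _        | _        =
      covered-by-shared-pair (edge-swap₂₃ vab) vcd λ { refl → cd≉ab (inj₂ (refl , refl)) }
    ... | no _     | no _     | yes refl | _        =
      covered-by-shared-pair vab (edge-swap₂₃ vcd) λ { refl → cd≉ab (inj₂ (refl , refl)) }
    ... | no _     | no _     | no _     | yes refl =
      covered-by-shared-pair (edge-swap₂₃ vab) (edge-swap₂₃ vcd) λ { refl → cd≉ab (inj₁ (refl , refl)) }
    ... | no c≢a   | no c≢b   | no d≢a   | no d≢b   =
      covered-by-copy (fan-copy vab vcd (c≢a ∘ sym) (d≢a ∘ sym) (c≢b ∘ sym) (d≢b ∘ sym)) 2F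

¬covering⇒δ₁≤3 : ∀ {n} (G : ThreeGraph n) → ¬ HasP₂Covering G → δ₁ G ≤ 3
¬covering⇒δ₁≤3 G uncovered with Fin.any? (λ v → degree G v ≤? 3)
... | yes (v , deg≤3) = ≤-trans (δ₁≤degree G v) deg≤3
... | no  ∄deg≤3      = ⊥-elim (uncovered (4≤degree⇒covering G λ v → ≰⇒> λ deg≤3 → ∄deg≤3 (v , deg≤3)))

module _ {n} (inFirst : Fin n → Bool) where

  IsCliqueEdge : Fin n → Fin n → Fin n → Set
  IsCliqueEdge a b c = a ≢ b × a ≢ c × b ≢ c × inFirst a ≡ inFirst b × inFirst a ≡ inFirst c

  isCliqueEdge? : ∀ a b c → Dec (IsCliqueEdge a b c)
  isCliqueEdge? a b c = ¬? (a ≟ b) ×-dec ¬? (a ≟ c) ×-dec ¬? (b ≟ c) ×-dec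
    inFirst a Bool.≟ inFirst b ×-dec inFirst a Bool.≟ inFirst c

  cliqueEdge-witness : ∀ {a b c} → does (isCliqueEdge? a b c) ≡ true → IsCliqueEdge a b c
  cliqueEdge-witness {a} {b} {c} = from-does (isCliqueEdge? a b c)

  cliquePair : ThreeGraph n
  cliquePair = record
    { edge       = λ a b c → does (isCliqueEdge? a b c)
    ; sym₁₂      = λ a b c → does-⇔ (mk⇔ swap₁₂ swap₁₂) (isCliqueEdge? a b c) (isCliqueEdge? b a c)
    ; sym₂₃      = λ a b c → does-⇔ (mk⇔ swap₂₃ swap₂₃) (isCliqueEdge? a b c) (isCliqueEdge? a c b)
    ; distinct₁₂ = λ a b c → proj₁ ∘ cliqueEdge-witness {a} {b} {c}
    ; distinct₁₃ = λ a b c → proj₁ ∘ proj₂ ∘ cliqueEdge-witness {a} {b} {c}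
    ; distinct₂₃ = λ a b c → proj₁ ∘ proj₂ ∘ proj₂ ∘ cliqueEdge-witness {a} {b} {c}
    }
    where
    swap₁₂ : ∀ {a b c} → IsCliqueEdge a b c → IsCliqueEdge b a c
    swap₁₂ (a≢b , a≢c , b≢c , ab , ac) = a≢b ∘ sym , b≢c , a≢c , sym ab , trans (sym ab) ac
    swap₂₃ : ∀ {a b c} → IsCliqueEdge a b c → IsCliqueEdge a c b
    swap₂₃ (a≢b , a≢c , b≢c , ab , ac) = a≢c , a≢b , b≢c ∘ sym , ac , ab

  copy-within-clique : ∀ {f} → CopyOfP₂ cliquePair f → ∀ i → inFirst (f i) ≡ inFirst (f 2F)
  copy-within-clique (_ , e₁ , e₂)
    with _ , _ , _ , s₀₁ , s₀₂ ← cliqueEdge-witness e₁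
       | _ , _ , _ , s₂₃ , s₂₄ ← cliqueEdge-witness e₂ = λ where
      0F → s₀₂
      1F → trans (sym s₀₁) s₀₂
      2F → refl
      3F → sym s₂₃
      4F → sym s₂₄

below4 : ∀ {n} → Fin n → Bool
below4 v = toℕ v <ᵇ 4

K₄∪Kₙ₋₄ : ∀ {n} → ThreeGraph n
K₄∪Kₙ₋₄ = cliquePair below4

K₄∪Kₙ₋₄-uncovered : ∀ {n} → ¬ HasP₂Covering (K₄∪Kₙ₋₄ {suc n})
K₄∪Kₙ₋₄-uncovered cover with cover 0F
... | f , copy@(f-inj , _) , i , fi≡0 = <-irrefl refl (injective⇒≤ f f-inj f<4)
  where
  f<4 : ∀ j → toℕ (f j) < 4
  f<4 j = <ᵇ⇒< _ _ (Equivalence.from T-≡ (begin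
    below4 (f j)  ≡⟨ copy-within-clique below4 copy j ⟩
    below4 (f 2F) ≡⟨ copy-within-clique below4 copy i ⟨
    below4 (f i)  ≡⟨ cong below4 fi≡0 ⟩
    true          ∎))
    where open ≡-Reasoning

K₄∪Kₙ₋₄-degree0≤3 : ∀ m → degree (K₄∪Kₙ₋₄ {4 + m}) 0F ≤ 3
K₄∪Kₙ₋₄-degree0≤3 m = degree≤length K 0F link⊆
  where
  K = K₄∪Kₙ₋₄ {4 + m}

  first-clique-pair : ∀ a b → T (toℕ a <ᵇ toℕ b) → 0F ≢ a → T (below4 a) → T (below4 b) →
          (a , b) ∈ (1F , 2F) ∷ (1F , 3F) ∷ (2F , 3F) ∷ []
  first-clique-pair 0F       _        _  0≢0 _  _  = ⊥-elim (0≢0 refl)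
  first-clique-pair _        0F       ()
  first-clique-pair (Fin.suc _) 1F    ()
  first-clique-pair 1F       2F       _  _   _  _  = here refl
  first-clique-pair 1F       3F       _  _   _  _  = there (here refl)
  first-clique-pair 2F       3F       _  _   _  _  = there (there (here refl))
  first-clique-pair 2F       2F       ()
  first-clique-pair 3F       2F       ()
  first-clique-pair 3F       3F       ()
  first-clique-pair (suc⁴ _) _        _  _   () _
  first-clique-pair _        (suc⁴ _) _  _   _  ()

  link⊆ : ∀ {p} → T (inLink K 0F p) → p ∈ (1F , 2F) ∷ (1F , 3F) ∷ (2F , 3F) ∷ []
  link⊆ {a , b} 0ab with Equivalence.to T-∧ 0ab
  ... | a<ᵇb , 0ab-edge with cliqueEdge-witness below4 {0F} {a} {b} (Equivalence.to T-≡ 0ab-edge)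
  ... | 0≢a , _ , _ , 0a , 0b = first-clique-pair a b a<ᵇb 0≢a (subst T 0a _) (subst T 0b _)

K₄∪Kₙ₋₄-3≤degree : ∀ m v → 3 ≤ degree (K₄∪Kₙ₋₄ {8 + m}) v
K₄∪Kₙ₋₄-3≤degree m = λ where
    0F → triangle 0F 1F 2F 3F refl refl refl
    1F → triangle 1F 0F 2F 3F refl refl refl
    2F → triangle 2F 0F 1F 3F refl refl refl
    3F → triangle 3F 0F 1F 2F refl refl refl
    4F → triangle 4F 5F 6F 7F refl refl refl
    5F → triangle 5F 4F 6F 7F refl refl refl
    6F → triangle 6F 4F 5F 7F refl refl refl
    7F → triangle 7F 4F 5F 6F refl refl refl
    (suc⁴ (suc⁴ v)) → triangle (suc⁴ (suc⁴ v)) 4F 5F 6F refl refl refl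
  where
  K = K₄∪Kₙ₋₄ {8 + m}
  triangle : ∀ v a b c {a<b : T (toℕ a <ᵇ toℕ b)} {b<c : T (toℕ b <ᵇ toℕ c)} →
             edge K v a b ≡ true → edge K v a c ≡ true → edge K v b c ≡ true → 3 ≤ degree K v
  triangle v a b c {a<b} {b<c} = link-triangle⇒3≤degree K v a b c (<ᵇ⇒< _ _ a<b) (<ᵇ⇒< _ _ b<c)

K₄∪Kₙ₋₄-δ₁ : ∀ m → δ₁ (K₄∪Kₙ₋₄ {8 + m}) ≡ 3
K₄∪Kₙ₋₄-δ₁ m = ≤-antisym
  (≤-trans (δ₁≤degree (K₄∪Kₙ₋₄ {8 + m}) 0F) (K₄∪Kₙ₋₄-degree0≤3 (4 + m)))
  (≤δ₁ K₄∪Kₙ₋₄ (K₄∪Kₙ₋₄-3≤degree m))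

theorem4 : (n : ℕ) → 8 ≤ n →
    (Σ (ThreeGraph n) λ G → ¬ HasP₂Covering G × δ₁ G ≡ 3) ×
    ((G : ThreeGraph n) → ¬ HasP₂Covering G → δ₁ G ≤ 3)
theorem4 .(8 + m) (s≤s (s≤s (s≤s (s≤s (s≤s (s≤s (s≤s (s≤s (z≤n {m}))))))))) =
  (K₄∪Kₙ₋₄ , K₄∪Kₙ₋₄-uncovered , K₄∪Kₙ₋₄-δ₁ m) , ¬covering⇒δ₁≤3
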